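{- Let $p$ be a prime and $l,k\ge0$ integers. The canonical homomorphisms $\Gamma_0(p^k)\cap GL_2(\mathbb Z)\to G^{\pm}_{l,k}$ and $\Gamma_0(p^k)\cap SL_2(\mathbb Z)\to G^1_{l,k}$ are surjective.
   Context: $\Gamma_0(p^k)$ is the subgroup of $GL_2(\mathbb Z_p)$ of matrices whose $(2,1)$ entry is divisible by $p^k$. $\Gamma(p^l,p^{l+k})=\{I+\mathrm{diag}[p^l,p^{l+k}]M\;:\;M\in M_2(\mathbb Z_p)\}\cap GL_2(\mathbb Z_p)$, a normal subgroup of $\Gamma_0(p^k)$, and $G_{l,k}=\Gamma_0(p^k)/\Gamma(p^l,p^{l+k})$. Put $U_0=\mathbb Z_p^\times$ and $U_m=1+p^m\mathbb Z_p$ for $m>0$. The determinant induces $\det_{l,k}:G_{l,k}\to U_0/U_l$; $G^1_{l,k}=\ker\det_{l,k}$ and $G^{\pm}_{l,k}=\det_{l,k}^{ -1}(\{\pm1\})$. The canonical homomorphisms are induced by the inclusions into $\Gamma_0(p^k)$ followed by the quotient map. -}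

module Defs where

open import Data.Nat as ℕ using (ℕ; zero; suc; _^_)
open import Data.Integer using (ℤ; +_; _+_; _-_; _*_; -_; 0ℤ; 1ℤ)
open import Data.Integer.Divisibility.Signed
  using (_∣_; divides; ∣m∣n⇒∣m+n; ∣n⇒∣m*n; ∣m⇒∣m*n; ∣m⇒∣-m)
open import Data.Integer.Properties using (i≡j⇒i-j≡0; *-zeroˡ)
open import Data.Product using (Σ; ∃; _×_; _,_)
open import Data.Sum using (_⊎_)
open import Relation.Binary.PropositionalEquality using (_≡_; refl; subst; sym)
import Data.Integer.Solver as Solver
open Solver.+-*-Solver using (solve; _:+_; _:-_; _:*_; :-_; _:=_)

-- 2×2 matrices over a type A, written  [[a , b] , [c , d]]

record M2 (A : Set) : Set where
  constructor mat
  field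
    a b c d : A

open M2 public

-- The p-adic integers ℤ_p, modelled as the inverse limit of the ℤ/p^n:
-- a sequence of integers x₀, x₁, … with x_{n+1} ≡ x_n (mod p^n).
-- The element represented is lim x_n; two such sequences represent the
-- same p-adic integer iff x_n ≡ y_n (mod p^n) for all n.

pow : ℕ → ℕ → ℤ
pow p n = + (p ^ n)

∣x-x : ∀ {m} x → m ∣ (x - x)
∣x-x {m} x = subst (m ∣_) (sym (i≡j⇒i-j≡0 {x} refl)) (divides 0ℤ (sym (*-zeroˡ m)))

record ℤp (p : ℕ) : Set where
  constructor zp
  field
    seq : ℕ → ℤ
    coh : ∀ n → pow p n ∣ (seq (suc n) - seq n)

open ℤp public

module _ {p : ℕ} where

  infix 4 _≈_ _≈M_
  infixl 7 _·_
  infixl 6 _⊕_ _⊖_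
  infixl 7 _⊛_

  _≈_ : ℤp p → ℤp p → Set
  x ≈ y = ∀ n → pow p n ∣ (seq x n - seq y n)

  ι : ℤ → ℤp p
  ι z = zp (λ _ → z) (λ _ → ∣x-x z)

  _⊕_ : ℤp p → ℤp p → ℤp p
  x ⊕ y = zp (λ n → seq x n + seq y n) λ n →
    subst (pow p n ∣_)
      (solve 4 (λ x' x y' y → (x' :- x) :+ (y' :- y) := (x' :+ y') :- (x :+ y)) refl
         (seq x (suc n)) (seq x n) (seq y (suc n)) (seq y n))
      (∣m∣n⇒∣m+n (coh x n) (coh y n))

  ⊝_ : ℤp p → ℤp p
  ⊝ x = zp (λ n → - seq x n) λ n →
    subst (pow p n ∣_)
      (solve 2 (λ x' x → :- (x' :- x) := (:- x') :- (:- x)) refl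
         (seq x (suc n)) (seq x n))
      (∣m⇒∣-m (coh x n))

  _⊖_ : ℤp p → ℤp p → ℤp p
  x ⊖ y = x ⊕ (⊝ y)

  _⊛_ : ℤp p → ℤp p → ℤp p
  x ⊛ y = zp (λ n → seq x n * seq y n) λ n →
    subst (pow p n ∣_)
      (solve 4 (λ x' x y' y → (x' :* (y' :- y)) :+ ((x' :- x) :* y) := (x' :* y') :- (x :* y)) refl
         (seq x (suc n)) (seq x n) (seq y (suc n)) (seq y n))
      (∣m∣n⇒∣m+n (∣n⇒∣m*n (seq x (suc n)) (coh y n)) (∣m⇒∣m*n (seq y n) (coh x n)))

  IsUnit : ℤp p → Set
  IsUnit x = ∃ λ y → x ⊛ y ≈ ι 1ℤ

  _∈p^_ℤp : ℤp p → ℕ → Set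
  x ∈p^ m ℤp = ∃ λ y → x ≈ ι (pow p m) ⊛ y

  InU : ℕ → ℤp p → Set
  InU zero    x = IsUnit x
  InU (suc m) x = (x ⊖ ι 1ℤ) ∈p^ (suc m) ℤp

  det : M2 (ℤp p) → ℤp p
  det g = a g ⊛ d g ⊖ b g ⊛ c g

  _·_ : M2 (ℤp p) → M2 (ℤp p) → M2 (ℤp p)
  g · h = mat (a g ⊛ a h ⊕ b g ⊛ c h) (a g ⊛ b h ⊕ b g ⊛ d h)
              (c g ⊛ a h ⊕ d g ⊛ c h) (c g ⊛ b h ⊕ d g ⊛ d h)

  _≈M_ : M2 (ℤp p) → M2 (ℤp p) → Set
  g ≈M h = (a g ≈ a h) × (b g ≈ b h) × (c g ≈ c h) × (d g ≈ d h)

  ιM : M2 ℤ → M2 (ℤp p)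
  ιM γ = mat (ι (a γ)) (ι (b γ)) (ι (c γ)) (ι (d γ))

  InGL2 : M2 (ℤp p) → Set
  InGL2 g = IsUnit (det g)

  InΓ₀ : ℕ → M2 (ℤp p) → Set
  InΓ₀ k g = InGL2 g × (c g ∈p^ k ℤp)

  InΓ : ℕ → ℕ → M2 (ℤp p) → Set
  InΓ l k h = InGL2 h × ∃ λ (M : M2 (ℤp p)) →
    h ≈M mat (ι 1ℤ ⊕ ι (pow p l) ⊛ a M)       (ι (pow p l) ⊛ b M)
             (ι (pow p (l ℕ.+ k)) ⊛ c M)       (ι 1ℤ ⊕ ι (pow p (l ℕ.+ k)) ⊛ d M)

  -- the image of γ ∈ Γ₀(p^k) in G_{l,k} = Γ₀(p^k)/Γ(p^l,p^{l+k}) is that of g,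
  -- i.e. g ∈ γ Γ(p^l,p^{l+k})
  SameClass : ℕ → ℕ → M2 (ℤp p) → M2 (ℤp p) → Set
  SameClass l k γ g = ∃ λ h → InΓ l k h × (g ≈M γ · h)

  InG± : ℕ → ℕ → M2 (ℤp p) → Set
  InG± l k g = InΓ₀ k g × (InU l (det g) ⊎ InU l (⊝ det g))

  InG¹ : ℕ → ℕ → M2 (ℤp p) → Set
  InG¹ l k g = InΓ₀ k g × InU l (det g)

detℤ : M2 ℤ → ℤ
detℤ γ = a γ * d γ - b γ * c γ

InΓ₀GL2ℤ : ℕ → ℕ → M2 ℤ → Set
InΓ₀GL2ℤ p k γ = (detℤ γ ≡ 1ℤ ⊎ detℤ γ ≡ - 1ℤ) × (pow p k ∣ c γ)

InΓ₀SL2ℤ : ℕ → ℕ → M2 ℤ → Set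
InΓ₀SL2ℤ p k γ = (detℤ γ ≡ 1ℤ) × (pow p k ∣ c γ)

module Submission where

-- Let N = l + k, let G and Y be the level-N approximations of g and of (det g)⁻¹, and let ε = ±1 be
-- the sign with ε · det g ∈ U_l.  The integer matrix G · diag(εY, ε) has determinant ≡ 1 mod p^N, so
-- it lifts to some γ′ ∈ SL₂(ℤ): SL₂(ℤ) → SL₂(ℤ/p^N) is onto, because after possibly adding the second
-- row to the first the (1,1) entry A is a unit mod p, and a matrix with first entry A can then be
-- completed explicitly.  Now γ = γ′ · diag(1, ε) has determinant ε, lies in Γ₀(p^k), and
-- γ ≡ G · diag(εY, 1), so γ⁻¹ G = ε · adj(γ) · G ≡ diag(ε det G, 1) mod p^N.  Since ε det G ≡ 1 mod p^l
-- this says that γ⁻¹ g ∈ Γ(p^l, p^{l+k}), i.e. γ and g have the same class.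

open import Defs
open import Data.Empty using (⊥-elim)
open import Level using (0ℓ)
open import Data.Integer
  using (ℤ; +_; _+_; _-_; _*_; -_; 0ℤ; 1ℤ; -1ℤ; ∣_∣; NonZero)
open import Data.Integer.Divisibility.Signed
open import Data.Integer.Properties
  using (pos-+; pos-*; +-identityˡ; +-identityʳ; *-identityˡ; *-identityʳ; *-comm; *-assoc;
         +-minus-telescope; +∣i∣≡i⊎+∣i∣≡-i; -1*i≡-i)
open import Data.Integer.Tactic.RingSolver using (solve)
open import Data.List.Base using ([]; _∷_)
open import Data.Nat.Base as ℕ using (ℕ; zero; suc; _^_)
import Data.Nat.Properties as ℕ
import Data.Nat.Divisibility as ℕ
open import Data.Nat.Coprimality using (Coprime; coprime-Bézout; coprime-divisor)
open import Data.Nat.GCD using (module Bézout)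
open import Data.Nat.Primality using (Prime; prime⇒nonZero; prime⇒irreducible; ¬prime[1])
open import Data.Product using (∃; _×_; _,_; map₂)
open import Data.Sum using (inj₁; inj₂)
open import Relation.Binary.Bundles using (Setoid)
open import Relation.Binary.PropositionalEquality
open import Relation.Nullary using (¬_; yes; no)
import Relation.Binary.Reasoning.Setoid as SetoidReasoning

infix 4 _≡_mod_

-- A record rather than a synonym for m ∣ x - y, so that x and y can be inferred from it.
record _≡_mod_ (x y m : ℤ) : Set where
  constructor congruent
  field
    difference : m ∣ x - y

open _≡_mod_

module _ {m : ℤ} where

  ≡-mod-reflexive : ∀ {x y} → x ≡ y → x ≡ y mod m
  ≡-mod-reflexive {x} refl = congruent (∣x-x x)

  ≡-mod-refl : ∀ {x} → x ≡ x mod m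
  ≡-mod-refl = ≡-mod-reflexive refl

  ≡-mod-sym : ∀ {x y} → x ≡ y mod m → y ≡ x mod m
  ≡-mod-sym {x} {y} (congruent m∣x-y) = congruent (subst (m ∣_) -[x-y]≡y-x (∣m⇒∣-m m∣x-y))
    where
    -[x-y]≡y-x : - (x - y) ≡ y - x
    -[x-y]≡y-x = solve (x ∷ y ∷ [])

  ≡-mod-trans : ∀ {x y z} → x ≡ y mod m → y ≡ z mod m → x ≡ z mod m
  ≡-mod-trans {x} {y} {z} (congruent h) (congruent h′) =
    congruent (subst (m ∣_) (+-minus-telescope x y z) (∣m∣n⇒∣m+n h h′))

  +-cong-mod : ∀ {x x′ y y′} → x ≡ x′ mod m → y ≡ y′ mod m → x + y ≡ x′ + y′ mod m
  +-cong-mod {x} {x′} {y} {y′} (congruent hx) (congruent hy) =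
    congruent (subst (m ∣_) regroup (∣m∣n⇒∣m+n hx hy))
    where
    regroup : (x - x′) + (y - y′) ≡ (x + y) - (x′ + y′)
    regroup = solve (x ∷ x′ ∷ y ∷ y′ ∷ [])

  -‿cong-mod : ∀ {x x′} → x ≡ x′ mod m → - x ≡ - x′ mod m
  -‿cong-mod {x} {x′} (congruent hx) = congruent (subst (m ∣_) regroup (∣m⇒∣-m hx))
    where
    regroup : - (x - x′) ≡ - x - - x′
    regroup = solve (x ∷ x′ ∷ [])

  *-cong-mod : ∀ {x x′ y y′} → x ≡ x′ mod m → y ≡ y′ mod m → x * y ≡ x′ * y′ mod m
  *-cong-mod {x} {x′} {y} {y′} (congruent hx) (congruent hy) =
    congruent (subst (m ∣_) regroup (∣m∣n⇒∣m+n (∣n⇒∣m*n x hy) (∣m⇒∣m*n y′ hx)))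
    where
    regroup : x * (y - y′) + (x - x′) * y′ ≡ x * y - x′ * y′
    regroup = solve (x ∷ x′ ∷ y ∷ y′ ∷ [])

  modulus≡0 : m ≡ 0ℤ mod m
  modulus≡0 = congruent (divides 1ℤ (trans (+-identityʳ m) (sym (*-identityˡ m))))

  ≡0-mod⇒∣ : ∀ {x} → x ≡ 0ℤ mod m → m ∣ x
  ≡0-mod⇒∣ {x} (congruent h) = subst (m ∣_) (+-identityʳ x) h

≡-mod-weaken : ∀ {n m x y} → n ∣ m → x ≡ y mod m → x ≡ y mod n
≡-mod-weaken n∣m (congruent h) = congruent (∣-trans n∣m h)

≡-mod-1 : ∀ {x y} → x ≡ y mod 1ℤ
≡-mod-1 {x} {y} = congruent (divides (x - y) (sym (*-identityʳ (x - y))))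

≡-mod-setoid : ℤ → Setoid 0ℓ 0ℓ
≡-mod-setoid m = record
  { Carrier = ℤ
  ; _≈_ = λ x y → x ≡ y mod m
  ; isEquivalence = record { refl = ≡-mod-refl ; sym = ≡-mod-sym ; trans = ≡-mod-trans } }

module ≡-mod-Reasoning (m : ℤ) = SetoidReasoning (≡-mod-setoid m)

infixl 7 _*ᴹ_
infixr 8 _·ᴹ_
infix 4 _≡ᴹ_mod_

_*ᴹ_ : M2 ℤ → M2 ℤ → M2 ℤ
X *ᴹ Y = mat (a X * a Y + b X * c Y) (a X * b Y + b X * d Y)
             (c X * a Y + d X * c Y) (c X * b Y + d X * d Y)

_·ᴹ_ : ℤ → M2 ℤ → M2 ℤ
s ·ᴹ X = mat (s * a X) (s * b X) (s * c X) (s * d X)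

adj : M2 ℤ → M2 ℤ
adj X = mat (d X) (- b X) (- c X) (a X)

diag : ℤ → ℤ → M2 ℤ
diag s t = mat s 0ℤ 0ℤ t

-- X *ᴹ diag s t, with the zero products already cancelled.
scaleCols : ℤ → ℤ → M2 ℤ → M2 ℤ
scaleCols s t X = mat (a X * s) (b X * t) (c X * s) (d X * t)

mat-cong : ∀ {A B C D A′ B′ C′ D′ : ℤ} → A ≡ A′ → B ≡ B′ → C ≡ C′ → D ≡ D′ →
           mat A B C D ≡ mat A′ B′ C′ D′
mat-cong refl refl refl refl = refl

detℤ-*ᴹ : ∀ X Y → detℤ (X *ᴹ Y) ≡ detℤ X * detℤ Y
detℤ-*ᴹ (mat A B C D) (mat A′ B′ C′ D′) = expanded
  where
  expanded : (A * A′ + B * C′) * (C * B′ + D * D′) - (A * B′ + B * D′) * (C * A′ + D * C′)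
           ≡ (A * D - B * C) * (A′ * D′ - B′ * C′)
  expanded = solve (A ∷ B ∷ C ∷ D ∷ A′ ∷ B′ ∷ C′ ∷ D′ ∷ [])

detℤ-·ᴹ-adj : ∀ s X → detℤ (s ·ᴹ adj X) ≡ s * s * detℤ X
detℤ-·ᴹ-adj s (mat A B C D) = expanded
  where
  expanded : s * D * (s * A) - s * - B * (s * - C) ≡ s * s * (A * D - B * C)
  expanded = solve (s ∷ A ∷ B ∷ C ∷ D ∷ [])

detℤ-scaleCols : ∀ s t X → detℤ (scaleCols s t X) ≡ s * t * detℤ X
detℤ-scaleCols s t (mat A B C D) = expanded
  where
  expanded : A * s * (D * t) - B * t * (C * s) ≡ s * t * (A * D - B * C)
  expanded = solve (s ∷ t ∷ A ∷ B ∷ C ∷ D ∷ [])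

*ᴹ-·ᴹ-adj-*ᴹ : ∀ s X Y → X *ᴹ (s ·ᴹ adj X *ᴹ Y) ≡ (s * detℤ X) ·ᴹ Y
*ᴹ-·ᴹ-adj-*ᴹ s (mat α β γ δ) (mat A B C D) = mat-cong (top A C) (top B D) (bottom A C) (bottom B D)
  where
  top : ∀ x y → α * (s * δ * x + s * - β * y) + β * (s * - γ * x + s * α * y)
              ≡ s * (α * δ - β * γ) * x
  top x y = solve (s ∷ α ∷ β ∷ γ ∷ δ ∷ x ∷ y ∷ [])
  bottom : ∀ x y → γ * (s * δ * x + s * - β * y) + δ * (s * - γ * x + s * α * y)
                 ≡ s * (α * δ - β * γ) * y
  bottom x y = solve (s ∷ α ∷ β ∷ γ ∷ δ ∷ x ∷ y ∷ [])

·ᴹ-adj-scaleCols-*ᴹ : ∀ s t X → s ·ᴹ adj (scaleCols t 1ℤ X) *ᴹ X ≡ diag (s * detℤ X) (s * t * detℤ X)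
·ᴹ-adj-scaleCols-*ᴹ s t (mat A B C D) = mat-cong entry-a entry-b entry-c entry-d
  where
  entry-a : s * (D * 1ℤ) * A + s * - (B * 1ℤ) * C ≡ s * (A * D - B * C)
  entry-a = solve (s ∷ A ∷ B ∷ C ∷ D ∷ [])
  entry-b : s * (D * 1ℤ) * B + s * - (B * 1ℤ) * D ≡ 0ℤ
  entry-b = solve (s ∷ B ∷ D ∷ [])
  entry-c : s * - (C * t) * A + s * (A * t) * C ≡ 0ℤ
  entry-c = solve (s ∷ t ∷ A ∷ C ∷ [])
  entry-d : s * - (C * t) * B + s * (A * t) * D ≡ s * t * (A * D - B * C)
  entry-d = solve (s ∷ t ∷ A ∷ B ∷ C ∷ D ∷ [])

scaleCols-scaleCols : ∀ s t s′ t′ X → scaleCols s t (scaleCols s′ t′ X) ≡ scaleCols (s′ * s) (t′ * t) X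
scaleCols-scaleCols s t s′ t′ X =
  mat-cong (*-assoc (a X) s′ s) (*-assoc (b X) t′ t) (*-assoc (c X) s′ s) (*-assoc (d X) t′ t)

record _≡ᴹ_mod_ (X Y : M2 ℤ) (m : ℤ) : Set where
  constructor entrywise
  field
    a-≡ : a X ≡ a Y mod m
    b-≡ : b X ≡ b Y mod m
    c-≡ : c X ≡ c Y mod m
    d-≡ : d X ≡ d Y mod m

module _ {m : ℤ} where

  ≡ᴹ-reflexive : ∀ {X Y} → X ≡ Y → X ≡ᴹ Y mod m
  ≡ᴹ-reflexive refl = entrywise (≡-mod-reflexive refl) (≡-mod-reflexive refl)
                                (≡-mod-reflexive refl) (≡-mod-reflexive refl)

  ≡ᴹ-trans : ∀ {X Y Z} → X ≡ᴹ Y mod m → Y ≡ᴹ Z mod m → X ≡ᴹ Z mod m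
  ≡ᴹ-trans (entrywise a₁ b₁ c₁ d₁) (entrywise a₂ b₂ c₂ d₂) =
    entrywise (≡-mod-trans a₁ a₂) (≡-mod-trans b₁ b₂) (≡-mod-trans c₁ c₂) (≡-mod-trans d₁ d₂)

  *ᴹ-cong-mod : ∀ {X X′ Y Y′} → X ≡ᴹ X′ mod m → Y ≡ᴹ Y′ mod m → X *ᴹ Y ≡ᴹ X′ *ᴹ Y′ mod m
  *ᴹ-cong-mod (entrywise a₁ b₁ c₁ d₁) (entrywise a₂ b₂ c₂ d₂) = entrywise
    (+-cong-mod (*-cong-mod a₁ a₂) (*-cong-mod b₁ c₂)) (+-cong-mod (*-cong-mod a₁ b₂) (*-cong-mod b₁ d₂))
    (+-cong-mod (*-cong-mod c₁ a₂) (*-cong-mod d₁ c₂)) (+-cong-mod (*-cong-mod c₁ b₂) (*-cong-mod d₁ d₂))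

  ·ᴹ-congʳ-mod : ∀ s {X Y} → X ≡ᴹ Y mod m → s ·ᴹ X ≡ᴹ s ·ᴹ Y mod m
  ·ᴹ-congʳ-mod s (entrywise a≡ b≡ c≡ d≡) = entrywise (*-cong-mod s≡s a≡) (*-cong-mod s≡s b≡)
                                                    (*-cong-mod s≡s c≡) (*-cong-mod s≡s d≡)
    where s≡s = ≡-mod-refl {x = s}

  adj-cong-mod : ∀ {X Y} → X ≡ᴹ Y mod m → adj X ≡ᴹ adj Y mod m
  adj-cong-mod (entrywise a≡ b≡ c≡ d≡) = entrywise d≡ (-‿cong-mod b≡) (-‿cong-mod c≡) a≡

  scaleCols-cong-mod : ∀ s t {X Y} → X ≡ᴹ Y mod m → scaleCols s t X ≡ᴹ scaleCols s t Y mod m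
  scaleCols-cong-mod s t (entrywise a≡ b≡ c≡ d≡) =
    entrywise (*-cong-mod a≡ (≡-mod-refl {x = s})) (*-cong-mod b≡ (≡-mod-refl {x = t}))
              (*-cong-mod c≡ (≡-mod-refl {x = s})) (*-cong-mod d≡ (≡-mod-refl {x = t}))

  ≡ᴹ-refl : ∀ {X} → X ≡ᴹ X mod m
  ≡ᴹ-refl = ≡ᴹ-reflexive refl

  ε[εY]d≡1 : ∀ ε Y D → ε * ε ≡ 1ℤ → D * Y ≡ 1ℤ mod m → ε * (ε * Y) * D ≡ 1ℤ mod m
  ε[εY]d≡1 ε Y D ε²≡1 DY≡1 = ≡-mod-trans (≡-mod-reflexive regroup) DY≡1
    where
    regroup : ε * (ε * Y) * D ≡ D * Y
    regroup = begin
      ε * (ε * Y) * D   ≡⟨ solve (ε ∷ Y ∷ D ∷ []) ⟩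
      ε * ε * (D * Y)   ≡⟨ cong (_* (D * Y)) ε²≡1 ⟩
      1ℤ * (D * Y)      ≡⟨ *-identityˡ (D * Y) ⟩
      D * Y             ∎
      where open ≡-Reasoning

  detℤ-scaleCols-unit : ∀ {ε Y} X → ε * ε ≡ 1ℤ → detℤ X * Y ≡ 1ℤ mod m →
                        detℤ (scaleCols (ε * Y) ε X) ≡ 1ℤ mod m
  detℤ-scaleCols-unit {ε} {Y} X ε²≡1 detX·Y≡1 = ≡-mod-trans
    (≡-mod-reflexive (trans (detℤ-scaleCols (ε * Y) ε X) (cong (_* detℤ X) (*-comm (ε * Y) ε))))
    (ε[εY]d≡1 ε Y (detℤ X) ε²≡1 detX·Y≡1)

  scaleCols-cancel-ε : ∀ ε t G {γ′} → ε * ε ≡ 1ℤ → γ′ ≡ᴹ scaleCols t ε G mod m →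
                       scaleCols 1ℤ ε γ′ ≡ᴹ scaleCols t 1ℤ G mod m
  scaleCols-cancel-ε ε t G ε²≡1 γ′≡ = ≡ᴹ-trans (scaleCols-cong-mod 1ℤ ε γ′≡) (≡ᴹ-reflexive (begin
    scaleCols 1ℤ ε (scaleCols t ε G)   ≡⟨ scaleCols-scaleCols 1ℤ ε t ε G ⟩
    scaleCols (t * 1ℤ) (ε * ε) G       ≡⟨ cong₂ (λ s t → scaleCols s t G) (*-identityʳ t) ε²≡1 ⟩
    scaleCols t 1ℤ G                   ∎))
    where open ≡-Reasoning

  ·ᴹ-adj-*ᴹ-≡diag : ∀ ε t G {γ} → γ ≡ᴹ scaleCols t 1ℤ G mod m →
                    ε ·ᴹ adj γ *ᴹ G ≡ᴹ diag (ε * detℤ G) (ε * t * detℤ G) mod m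
  ·ᴹ-adj-*ᴹ-≡diag ε t G γ≡ = ≡ᴹ-trans (*ᴹ-cong-mod (·ᴹ-congʳ-mod ε (adj-cong-mod γ≡)) ≡ᴹ-refl)
                                      (≡ᴹ-reflexive (·ᴹ-adj-scaleCols-*ᴹ ε t G))

SL₂Lift : ℤ → M2 ℤ → Set
SL₂Lift m G = ∃ λ γ → detℤ γ ≡ 1ℤ × γ ≡ᴹ G mod m

-- When A u ≡ 1 mod m the b- and c-entries are ≡ B and C, and the d-entry is chosen to make the
-- determinant exactly A u - q m².
SL₂-completion : ℤ → ℤ → ℤ → M2 ℤ → M2 ℤ
SL₂-completion m u q (mat A B C D) =
  let c′ = C * (A * u) + m * q in mat A (B * (A * u) + m) c′ (c′ * (B * u) + C * u * m + u)

detℤ-SL₂-completion : ∀ m u q G → a G * u - 1ℤ ≡ q * (m * m) → detℤ (SL₂-completion m u q G) ≡ 1ℤ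
detℤ-SL₂-completion m u q (mat A B C D) Au-1≡qm² = begin
  A * ((C * (A * u) + m * q) * (B * u) + C * u * m + u) - (B * (A * u) + m) * (C * (A * u) + m * q)
                            ≡⟨ solve (A ∷ B ∷ C ∷ u ∷ m ∷ q ∷ []) ⟩
  A * u - q * (m * m)       ≡⟨ cong (λ z → A * u - z) Au-1≡qm² ⟨
  A * u - (A * u - 1ℤ)      ≡⟨ solve (A ∷ u ∷ []) ⟩
  1ℤ                        ∎
  where open ≡-Reasoning

SL₂-completion-≡ᴹ : ∀ m u q G → a G * u ≡ 1ℤ mod m → detℤ G ≡ 1ℤ mod m → SL₂-completion m u q G ≡ᴹ G mod m
SL₂-completion-≡ᴹ m u q (mat A B C D) Au≡1 det≡1 = entrywise ≡-mod-refl b≡B c≡C d≡D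
  where
  open ≡-mod-Reasoning m

  AD≡1+BC : A * D ≡ 1ℤ + B * C mod m
  AD≡1+BC = ≡-mod-trans (≡-mod-reflexive (regroup A B C D)) (+-cong-mod det≡1 (≡-mod-refl {x = B * C}))
    where
    regroup : ∀ A B C D → A * D ≡ (A * D - B * C) + B * C
    regroup A B C D = solve (A ∷ B ∷ C ∷ D ∷ [])

  b≡B : B * (A * u) + m ≡ B mod m
  b≡B = begin
    B * (A * u) + m   ≈⟨ +-cong-mod (*-cong-mod (≡-mod-refl {x = B}) Au≡1) modulus≡0 ⟩
    B * 1ℤ + 0ℤ       ≡⟨ solve (B ∷ []) ⟩
    B                 ∎

  c≡C : C * (A * u) + m * q ≡ C mod m
  c≡C = begin
    C * (A * u) + m * q   ≈⟨ +-cong-mod (*-cong-mod (≡-mod-refl {x = C}) Au≡1)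
                                        (*-cong-mod modulus≡0 (≡-mod-refl {x = q})) ⟩
    C * 1ℤ + 0ℤ * q       ≡⟨ solve (C ∷ q ∷ []) ⟩
    C                     ∎

  d≡D : (C * (A * u) + m * q) * (B * u) + C * u * m + u ≡ D mod m
  d≡D = begin
    (C * (A * u) + m * q) * (B * u) + C * u * m + u
      ≈⟨ +-cong-mod (+-cong-mod (*-cong-mod c≡C (≡-mod-refl {x = B * u}))
                                (*-cong-mod (≡-mod-refl {x = C * u}) modulus≡0)) (≡-mod-refl {x = u}) ⟩
    C * (B * u) + C * u * 0ℤ + u   ≡⟨ solve (B ∷ C ∷ u ∷ []) ⟩
    u * (1ℤ + B * C)               ≈⟨ *-cong-mod (≡-mod-refl {x = u}) AD≡1+BC ⟨
    u * (A * D)                    ≡⟨ solve (A ∷ D ∷ u ∷ []) ⟩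
    A * u * D                      ≈⟨ *-cong-mod Au≡1 (≡-mod-refl {x = D}) ⟩
    1ℤ * D                         ≡⟨ *-identityˡ D ⟩
    D                              ∎

SL₂Lift-subtract-row : ∀ {m A B C D} → SL₂Lift m (mat (A + C) (B + D) C D) → SL₂Lift m (mat A B C D)
SL₂Lift-subtract-row {m} (mat α β γ δ , det≡1 , entrywise α≡ β≡ γ≡ δ≡) =
  mat (α - γ) (β - δ) γ δ , trans (subtract-row-det α β γ δ) det≡1 ,
  entrywise (subtract α≡ γ≡) (subtract β≡ δ≡) γ≡ δ≡
  where
  subtract-row-det : ∀ A B C D → (A - C) * D - (B - D) * C ≡ A * D - B * C
  subtract-row-det A B C D = solve (A ∷ B ∷ C ∷ D ∷ [])

  subtract : ∀ {x y X Y} → x ≡ X + Y mod m → y ≡ Y mod m → x - y ≡ X mod m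
  subtract {X = X} {Y} x≡ y≡ = ≡-mod-trans (+-cong-mod x≡ (-‿cong-mod y≡)) (≡-mod-reflexive (cancel X Y))
    where
    cancel : ∀ X Y → X + Y - Y ≡ X
    cancel X Y = solve (X ∷ Y ∷ [])

coprime-*ʳ : ∀ {m n o} → Coprime m n → Coprime m o → Coprime m (n ℕ.* o)
coprime-*ʳ {n = n} m⊥n m⊥o {d} (d∣m , d∣no) = m⊥o (d∣m , coprime-divisor d⊥n d∣no)
  where
  d⊥n : Coprime d n
  d⊥n (e∣d , e∣n) = m⊥n (ℕ.∣-trans e∣d d∣m , e∣n)

coprime-^ʳ : ∀ {m n} → Coprime m n → ∀ k → Coprime m (n ^ k)
coprime-^ʳ m⊥n zero    (_ , d∣1) = ℕ.∣1⇒≡1 d∣1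
coprime-^ʳ m⊥n (suc k) = coprime-*ʳ m⊥n (coprime-^ʳ m⊥n k)

pos-1+*≡* : ∀ x y z w → 1 ℕ.+ x ℕ.* y ≡ z ℕ.* w → 1ℤ + + x * + y ≡ + z * + w
pos-1+*≡* x y z w e = begin
  1ℤ + + x * + y        ≡⟨ cong (λ z → 1ℤ + z) (pos-* x y) ⟨
  1ℤ + + (x ℕ.* y)      ≡⟨ pos-+ 1 (x ℕ.* y) ⟨
  + (1 ℕ.+ x ℕ.* y)     ≡⟨ cong +_ e ⟩
  + (z ℕ.* w)           ≡⟨ pos-* z w ⟩
  + z * + w             ∎
  where open ≡-Reasoning

coprime⇒inverse-mod : ∀ {n m} → Coprime n m → ∃ λ u → + n * u ≡ 1ℤ mod + m
coprime⇒inverse-mod {n} {m} n⊥m with coprime-Bézout n⊥m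
... | Bézout.+- x y eq = + x , congruent (divides (+ y) (inverse (+ n) (+ x) (+ y) (+ m) (pos-1+*≡* y m x n eq)))
  where
  inverse : ∀ n x y m → 1ℤ + y * m ≡ x * n → n * x - 1ℤ ≡ y * m
  inverse n x y m e = begin
    n * x - 1ℤ        ≡⟨ cong (_- 1ℤ) (trans (*-comm n x) (sym e)) ⟩
    1ℤ + y * m - 1ℤ   ≡⟨ solve (y ∷ m ∷ []) ⟩
    y * m             ∎
    where open ≡-Reasoning
... | Bézout.-+ x y eq = - + x , congruent (divides (- + y) (inverse (+ n) (+ x) (+ y) (+ m) (pos-1+*≡* x n y m eq)))
  where
  inverse : ∀ n x y m → 1ℤ + x * n ≡ y * m → n * - x - 1ℤ ≡ - y * m
  inverse n x y m e = begin
    n * - x - 1ℤ      ≡⟨ solve (n ∷ x ∷ []) ⟩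
    - (1ℤ + x * n)    ≡⟨ cong -_ e ⟩
    - (y * m)         ≡⟨ solve (y ∷ m ∷ []) ⟩
    - y * m           ∎
    where open ≡-Reasoning

InΓ-mod : ℕ → ℕ → ℕ → M2 ℤ → Set
InΓ-mod p l k H = (a H ≡ 1ℤ mod pow p l) × (b H ≡ 0ℤ mod pow p l)
                × (c H ≡ 0ℤ mod pow p (l ℕ.+ k)) × (d H ≡ 1ℤ mod pow p (l ℕ.+ k))

module _ {p : ℕ} where

  pow-+ : ∀ m n → pow p (m ℕ.+ n) ≡ pow p m * pow p n
  pow-+ m n = trans (cong +_ (ℕ.^-distribˡ-+-* p m n)) (pos-* (p ^ m) (p ^ n))

  pow-mono-∣ : ∀ {m n} → m ℕ.≤ n → pow p m ∣ pow p n
  pow-mono-∣ {m} {n} m≤n = subst (λ k → pow p m ∣ pow p k) (ℕ.m+[n∸m]≡n m≤n)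
    (divides (pow p (n ℕ.∸ m)) (trans (pow-+ m (n ℕ.∸ m)) (*-comm (pow p m) _)))

  Γ₀-representative-from-SL₂ : ∀ l k G Y ε → ε * ε ≡ 1ℤ → detℤ G * Y ≡ 1ℤ mod pow p (l ℕ.+ k) →
    ε * detℤ G ≡ 1ℤ mod pow p l → c G ≡ 0ℤ mod pow p k →
    ∀ γ′ → detℤ γ′ ≡ 1ℤ → γ′ ≡ᴹ scaleCols (ε * Y) ε G mod pow p (l ℕ.+ k) →
    let γ = scaleCols 1ℤ ε γ′ in detℤ γ ≡ ε × pow p k ∣ c γ × InΓ-mod p l k (ε ·ᴹ adj γ *ᴹ G)
  Γ₀-representative-from-SL₂ l k G Y ε ε²≡1 detG·Y≡1 εdetG≡1 cG≡0 γ′ det-γ′≡1 γ′≡ =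
    det-γ , ≡0-mod⇒∣ cγ≡0 , a≡1 , b≡0 , c-≡ , d≡1
    where
    N = l ℕ.+ k
    t = ε * Y
    γ = scaleCols 1ℤ ε γ′
    H = ε ·ᴹ adj γ *ᴹ G

    det-γ : detℤ γ ≡ ε
    det-γ = begin
      detℤ γ              ≡⟨ detℤ-scaleCols 1ℤ ε γ′ ⟩
      1ℤ * ε * detℤ γ′    ≡⟨ cong (1ℤ * ε *_) det-γ′≡1 ⟩
      1ℤ * ε * 1ℤ         ≡⟨ solve (ε ∷ []) ⟩
      ε                   ∎
      where open ≡-Reasoning

    γ≡G·diag[t,1] : γ ≡ᴹ scaleCols t 1ℤ G mod pow p N
    γ≡G·diag[t,1] = scaleCols-cancel-ε ε t G ε²≡1 γ′≡

    open _≡ᴹ_mod_ (·ᴹ-adj-*ᴹ-≡diag ε t G γ≡G·diag[t,1])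

    pˡ∣pᴺ : pow p l ∣ pow p N
    pˡ∣pᴺ = pow-mono-∣ (ℕ.m≤m+n l k)

    a≡1 : a H ≡ 1ℤ mod pow p l
    a≡1 = ≡-mod-trans (≡-mod-weaken pˡ∣pᴺ a-≡) εdetG≡1

    b≡0 : b H ≡ 0ℤ mod pow p l
    b≡0 = ≡-mod-weaken pˡ∣pᴺ b-≡

    d≡1 : d H ≡ 1ℤ mod pow p N
    d≡1 = ≡-mod-trans d-≡ (ε[εY]d≡1 ε Y (detℤ G) ε²≡1 detG·Y≡1)

    cγ≡0 : c γ ≡ 0ℤ mod pow p k
    cγ≡0 = begin
      c γ          ≈⟨ ≡-mod-weaken (pow-mono-∣ (ℕ.m≤n+m k l)) (_≡ᴹ_mod_.c-≡ γ≡G·diag[t,1]) ⟩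
      c G * t      ≈⟨ *-cong-mod cG≡0 ≡-mod-refl ⟩
      0ℤ           ∎
      where open ≡-mod-Reasoning (pow p k)

difference-of-quotients : ∀ x′ x c q′ q P → x′ - c ≡ q′ * P → x - c ≡ q * P → x′ - x ≡ P * (q′ - q)
difference-of-quotients x′ x c q′ q P e′ e = begin
  x′ - x                 ≡⟨ solve (x′ ∷ x ∷ c ∷ []) ⟩
  (x′ - c) - (x - c)     ≡⟨ cong₂ _-_ e′ e ⟩
  q′ * P - q * P         ≡⟨ solve (q′ ∷ q ∷ P ∷ []) ⟩
  P * (q′ - q)           ∎
  where open ≡-Reasoning

quotient-rebuild : ∀ x c q P → x - c ≡ q * P → c + P * q ≡ x
quotient-rebuild x c q P e = begin
  c + P * q      ≡⟨ cong (λ z → c + z) (trans (*-comm P q) (sym e)) ⟩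
  c + (x - c)    ≡⟨ solve (x ∷ c ∷ []) ⟩
  x              ∎
  where open ≡-Reasoning

approx : ∀ {p} → ℕ → M2 (ℤp p) → M2 ℤ
approx n g = mat (seq (a g) n) (seq (b g) n) (seq (c g) n) (seq (d g) n)

module _ {p : ℕ} .{{_ : ℕ.NonZero p}} where

  pow-nonZero : ∀ n → NonZero (pow p n)
  pow-nonZero n = ℕ.m^n≢0 p n

  seq-≡-mod : (x : ℤp p) → ∀ {m n} → m ℕ.≤ n → seq x n ≡ seq x m mod pow p m
  seq-≡-mod x {m} {n} m≤n =
    subst (λ n → seq x n ≡ seq x m mod pow p m) (ℕ.m∸n+n≡m m≤n) (drift (n ℕ.∸ m))
    where
    drift : ∀ j → seq x (j ℕ.+ m) ≡ seq x m mod pow p m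
    drift zero    = ≡-mod-refl
    drift (suc j) = ≡-mod-trans
      (≡-mod-weaken (pow-mono-∣ (ℕ.m≤n+m m j)) (congruent (coh x (j ℕ.+ m)))) (drift j)

  ∈p^ℤp-level : ∀ (x : ℤp p) {m n} → x ∈p^ m ℤp → m ℕ.≤ n → seq x n ≡ 0ℤ mod pow p m
  ∈p^ℤp-level x {m} {n} (y , x≈pᵐy) m≤n = begin
    seq x n            ≈⟨ ≡-mod-weaken (pow-mono-∣ m≤n) (congruent (x≈pᵐy n)) ⟩
    pow p m * seq y n  ≈⟨ *-cong-mod modulus≡0 ≡-mod-refl ⟩
    0ℤ                 ∎
    where open ≡-mod-Reasoning (pow p m)

  InU-level : ∀ (x : ℤp p) l {n} → InU l x → l ℕ.≤ n → seq x n ≡ 1ℤ mod pow p l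
  InU-level x zero    _     _   = ≡-mod-1
  InU-level x (suc m) x-1∈U l≤n = congruent (≡0-mod⇒∣ (∈p^ℤp-level (x ⊖ ι 1ℤ) x-1∈U l≤n))

  ≈+p^ℤp-from-level : ∀ (x : ℤp p) {m N} c → m ℕ.≤ N → seq x N ≡ c mod pow p m →
                      ∃ λ y → x ≈ ι c ⊕ ι (pow p m) ⊛ y
  ≈+p^ℤp-from-level x {m} {N} c m≤N x≡c = zp q q-coh , x≈c+pᵐq
    where
    tail≡c : ∀ n → seq x (n ℕ.+ N) ≡ c mod pow p m
    tail≡c n = ≡-mod-trans (≡-mod-weaken (pow-mono-∣ m≤N) (seq-≡-mod x (ℕ.m≤n+m N n))) x≡c

    q : ℕ → ℤ
    q n = quotient (difference (tail≡c n))

    q-spec : ∀ n → seq x (n ℕ.+ N) - c ≡ q n * pow p m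
    q-spec n = _∣_.equality (difference (tail≡c n))

    q-coh : ∀ n → pow p n ∣ q (suc n) - q n
    q-coh n = *-cancelˡ-∣ (pow p m) {pow p n} {q (suc n) - q n} {{pow-nonZero m}} (subst₂ _∣_ (pow-+ m n)
      (difference-of-quotients (seq x (suc n ℕ.+ N)) (seq x (n ℕ.+ N)) c (q (suc n)) (q n) (pow p m)
         (q-spec (suc n)) (q-spec n))
      (∣-trans (pow-mono-∣ m+n≤n+N) (coh x (n ℕ.+ N))))
      where
      m+n≤n+N : m ℕ.+ n ℕ.≤ n ℕ.+ N
      m+n≤n+N = subst (m ℕ.+ n ℕ.≤_) (ℕ.+-comm N n) (ℕ.+-monoˡ-≤ n m≤N)

    x≈c+pᵐq : x ≈ ι c ⊕ ι (pow p m) ⊛ zp q q-coh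
    x≈c+pᵐq n = difference (≡-mod-trans (≡-mod-sym (seq-≡-mod x (ℕ.m≤m+n n N)))
      (≡-mod-reflexive (sym (quotient-rebuild (seq x (n ℕ.+ N)) c (q n) (pow p m) (q-spec n)))))

  ≈p^ℤp-from-level : ∀ (x : ℤp p) {m N} → m ℕ.≤ N → seq x N ≡ 0ℤ mod pow p m →
                     ∃ λ y → x ≈ ι (pow p m) ⊛ y
  ≈p^ℤp-from-level x {m} m≤N x≡0 = drop-zero (≈+p^ℤp-from-level x 0ℤ m≤N x≡0)
    where
    drop-zero : (∃ λ y → x ≈ ι 0ℤ ⊕ ι (pow p m) ⊛ y) → ∃ λ y → x ≈ ι (pow p m) ⊛ y
    drop-zero (y , x≈0+pᵐy) = y , λ n → subst (λ z → pow p n ∣ seq x n - z) (+-identityˡ _) (x≈0+pᵐy n)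

  InΓ-from-level : ∀ l k (h : M2 (ℤp p)) → InGL2 h → InΓ-mod p l k (approx (l ℕ.+ k) h) → InΓ l k h
  InΓ-from-level l k h h-unit (a≡1 , b≡0 , c≡0 , d≡1) =
    assemble (≈+p^ℤp-from-level (a h) 1ℤ l≤N a≡1) (≈p^ℤp-from-level (b h) l≤N b≡0)
             (≈p^ℤp-from-level (c h) ℕ.≤-refl c≡0) (≈+p^ℤp-from-level (d h) 1ℤ ℕ.≤-refl d≡1)
    where
    l≤N = ℕ.m≤m+n l k
    N = l ℕ.+ k
    assemble : (∃ λ yA → a h ≈ ι 1ℤ ⊕ ι (pow p l) ⊛ yA) → (∃ λ yB → b h ≈ ι (pow p l) ⊛ yB) →
               (∃ λ yC → c h ≈ ι (pow p N) ⊛ yC) → (∃ λ yD → d h ≈ ι 1ℤ ⊕ ι (pow p N) ⊛ yD) →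
               InΓ l k h
    assemble (yA , hA) (yB , hB) (yC , hC) (yD , hD) = h-unit , mat yA yB yC yD , hA , hB , hC , hD

  InGL2-ιM-· : ∀ X s (g : M2 (ℤp p)) → detℤ X * s ≡ 1ℤ → InGL2 g → InGL2 (ιM X · g)
  InGL2-ιM-· X s g detX·s≡1 (y , det·y≈1) = ι s ⊛ y , λ n → difference (inverse-at n)
    where
    interchange : ∀ w x y z → w * x * (y * z) ≡ w * y * (x * z)
    interchange w x y z = solve (w ∷ x ∷ y ∷ z ∷ [])

    inverse-at : ∀ n → detℤ (X *ᴹ approx n g) * (s * seq y n) ≡ 1ℤ mod pow p n
    inverse-at n = begin
      detℤ (X *ᴹ G) * (s * seq y n)      ≡⟨ cong (_* (s * seq y n)) (detℤ-*ᴹ X G) ⟩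
      detℤ X * detℤ G * (s * seq y n)    ≡⟨ interchange (detℤ X) (detℤ G) s (seq y n) ⟩
      detℤ X * s * (detℤ G * seq y n)    ≡⟨ cong (_* (detℤ G * seq y n)) detX·s≡1 ⟩
      1ℤ * (detℤ G * seq y n)            ≡⟨ *-identityˡ _ ⟩
      detℤ G * seq y n                   ≈⟨ congruent (det·y≈1 n) ⟩
      1ℤ                                 ∎
      where
      open ≡-mod-Reasoning (pow p n)
      G = approx n g

  ≈M-ιM-· : ∀ γ X → (∀ G → γ *ᴹ (X *ᴹ G) ≡ G) → (g : M2 (ℤp p)) → g ≈M ιM γ · (ιM X · g)
  ≈M-ιM-· γ X γX≡1 g =
    (λ n → at a n) , (λ n → at b n) , (λ n → at c n) , (λ n → at d n)
    where
    at : (f : M2 ℤ → ℤ) → ∀ n → pow p n ∣ f (approx n g) - f (γ *ᴹ (X *ᴹ approx n g))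
    at f n = difference (≡-mod-reflexive (sym (cong f (γX≡1 (approx n g)))))

  SameClass-from-level : ∀ l k (g : M2 (ℤp p)) γ ε → InGL2 g → ε * ε ≡ 1ℤ → detℤ γ ≡ ε →
                         InΓ-mod p l k (ε ·ᴹ adj γ *ᴹ approx (l ℕ.+ k) g) → SameClass l k (ιM γ) g
  SameClass-from-level l k g γ ε g-unit ε²≡1 det-γ≡ε H∈Γ =
    ιM X · g , InΓ-from-level l k (ιM X · g) (InGL2-ιM-· X ε g det-X·ε≡1 g-unit) H∈Γ ,
    ≈M-ιM-· γ X (λ G → trans (*ᴹ-·ᴹ-adj-*ᴹ ε γ G) (scalar-one G)) g
    where
    X = ε ·ᴹ adj γ

    det-X·ε≡1 : detℤ X * ε ≡ 1ℤ
    det-X·ε≡1 = begin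
      detℤ X * ε               ≡⟨ cong (_* ε) (detℤ-·ᴹ-adj ε γ) ⟩
      ε * ε * detℤ γ * ε       ≡⟨ cong (λ z → ε * ε * z * ε) det-γ≡ε ⟩
      ε * ε * ε * ε            ≡⟨ solve (ε ∷ []) ⟩
      (ε * ε) * (ε * ε)        ≡⟨ cong₂ _*_ ε²≡1 ε²≡1 ⟩
      1ℤ                       ∎
      where open ≡-Reasoning

    scalar-one : ∀ G → (ε * detℤ γ) ·ᴹ G ≡ G
    scalar-one (mat A B C D) = begin
      (ε * detℤ γ) ·ᴹ mat A B C D  ≡⟨ cong (λ z → z ·ᴹ mat A B C D) (trans (cong (ε *_) det-γ≡ε) ε²≡1) ⟩
      1ℤ ·ᴹ mat A B C D            ≡⟨ mat-cong (*-identityˡ A) (*-identityˡ B) (*-identityˡ C) (*-identityˡ D) ⟩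
      mat A B C D                  ∎
      where open ≡-Reasoning

module _ {p : ℕ} (p-prime : Prime p) where

  private instance
    p-nonZero : ℕ.NonZero p
    p-nonZero = prime⇒nonZero p-prime

  ∤⇒coprime : ∀ {A} → ¬ (+ p ∣ A) → Coprime ∣ A ∣ p
  ∤⇒coprime p∤A (d∣A , d∣p) with prime⇒irreducible p-prime d∣p
  ... | inj₁ d≡1  = d≡1
  ... | inj₂ refl = ⊥-elim (p∤A (∣ᵤ⇒∣ d∣A))

  inverse-mod-pow : ∀ M {A} → ¬ (+ p ∣ A) → ∃ λ u → A * u ≡ 1ℤ mod pow p M
  inverse-mod-pow M {A} p∤A with coprime⇒inverse-mod (coprime-^ʳ (∤⇒coprime p∤A) M) | +∣i∣≡i⊎+∣i∣≡-i A
  ... | u , ∣A∣u≡1 | inj₁ ∣A∣≡A  = u , subst (λ z → z * u ≡ 1ℤ mod pow p M) ∣A∣≡A ∣A∣u≡1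
  ... | u , ∣A∣u≡1 | inj₂ ∣A∣≡-A =
    - u , ≡-mod-trans (≡-mod-reflexive (move-sign A u)) (subst (λ z → z * u ≡ 1ℤ mod pow p M) ∣A∣≡-A ∣A∣u≡1)
    where
    move-sign : ∀ A u → A * - u ≡ - A * u
    move-sign A u = solve (A ∷ u ∷ [])

  ∣a⇒∤c : ∀ G → detℤ G ≡ 1ℤ mod + p → + p ∣ a G → ¬ (+ p ∣ c G)
  ∣a⇒∤c (mat A B C D) (congruent p∣det-1) p∣A p∣C =
    ¬prime[1] (subst Prime (ℕ.∣1⇒≡1 (∣⇒∣ᵤ p∣1)) p-prime)
    where
    cancel : ∀ A B C D → (A * D - B * C) - (A * D - B * C - 1ℤ) ≡ 1ℤ
    cancel A B C D = solve (A ∷ B ∷ C ∷ D ∷ [])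

    p∣det : + p ∣ A * D - B * C
    p∣det = ∣m∣n⇒∣m-n (∣m⇒∣m*n D p∣A) (∣n⇒∣m*n B p∣C)

    p∣1 : + p ∣ 1ℤ
    p∣1 = subst (+ p ∣_) (cancel A B C D) (∣m∣n⇒∣m-n p∣det p∣det-1)

  SL₂-lift-unit : ∀ N G → detℤ G ≡ 1ℤ mod pow p N → ¬ (+ p ∣ a G) → SL₂Lift (pow p N) G
  SL₂-lift-unit N G det≡1 p∤a with inverse-mod-pow (N ℕ.+ N) p∤a
  ... | u , au≡1 = SL₂-completion (pow p N) u q G ,
    detℤ-SL₂-completion (pow p N) u q G (trans (_∣_.equality (difference au≡1)) (cong (q *_) (pow-+ N N))) ,
    SL₂-completion-≡ᴹ (pow p N) u q G (≡-mod-weaken (pow-mono-∣ (ℕ.m≤m+n N N)) au≡1) det≡1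
    where q = quotient (difference au≡1)

  SL₂-lift : ∀ N G → detℤ G ≡ 1ℤ mod pow p N → SL₂Lift (pow p N) G
  SL₂-lift N G det≡1 with + p ∣? a G
  ... | no p∤a = SL₂-lift-unit N G det≡1 p∤a
  SL₂-lift zero G _ | yes _ = diag 1ℤ 1ℤ , refl , entrywise ≡-mod-1 ≡-mod-1 ≡-mod-1 ≡-mod-1
  SL₂-lift (suc N) (mat A B C D) det≡1 | yes p∣A =
    SL₂Lift-subtract-row (SL₂-lift-unit (suc N) (mat (A + C) (B + D) C D)
                            (≡-mod-trans (≡-mod-reflexive (add-row-det A B C D)) det≡1) p∤A+C)
    where
    add-row-det : ∀ A B C D → (A + C) * D - (B + D) * C ≡ A * D - B * C
    add-row-det A B C D = solve (A ∷ B ∷ C ∷ D ∷ [])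

    p∣pᴺ⁺¹ : + p ∣ pow p (suc N)
    p∣pᴺ⁺¹ = divides (pow p N) (trans (pos-* p (p ^ N)) (*-comm (+ p) (pow p N)))

    p∤A+C : ¬ (+ p ∣ A + C)
    p∤A+C p∣A+C = ∣a⇒∤c (mat A B C D) (≡-mod-weaken p∣pᴺ⁺¹ det≡1) p∣A (∣m+n∣m⇒∣n p∣A+C p∣A)

  Γ₀-representative-mod : ∀ l k G Y ε → ε * ε ≡ 1ℤ → detℤ G * Y ≡ 1ℤ mod pow p (l ℕ.+ k) →
    ε * detℤ G ≡ 1ℤ mod pow p l → c G ≡ 0ℤ mod pow p k →
    ∃ λ γ → detℤ γ ≡ ε × pow p k ∣ c γ × InΓ-mod p l k (ε ·ᴹ adj γ *ᴹ G)
  Γ₀-representative-mod l k G Y ε ε²≡1 detG·Y≡1 εdetG≡1 cG≡0 =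
    correct (SL₂-lift (l ℕ.+ k) (scaleCols (ε * Y) ε G) (detℤ-scaleCols-unit G ε²≡1 detG·Y≡1))
    where
    correct : SL₂Lift (pow p (l ℕ.+ k)) (scaleCols (ε * Y) ε G) →
              ∃ λ γ → detℤ γ ≡ ε × pow p k ∣ c γ × InΓ-mod p l k (ε ·ᴹ adj γ *ᴹ G)
    correct (γ′ , det-γ′≡1 , γ′≡) =
      scaleCols 1ℤ ε γ′ , Γ₀-representative-from-SL₂ l k G Y ε ε²≡1 detG·Y≡1 εdetG≡1 cG≡0 γ′ det-γ′≡1 γ′≡

  Γ₀-representative : ∀ l k (g : M2 (ℤp p)) → InΓ₀ k g → ∀ ε → ε * ε ≡ 1ℤ →
    ε * seq (det g) (l ℕ.+ k) ≡ 1ℤ mod pow p l →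
    ∃ λ γ → detℤ γ ≡ ε × pow p k ∣ c γ × SameClass l k (ιM γ) g
  Γ₀-representative l k g (g-unit@(y , det·y≈1) , c∈pᵏℤp) ε ε²≡1 εdet≡1 =
    to-class (Γ₀-representative-mod l k (approx N g) (seq y N) ε ε²≡1 (congruent (det·y≈1 N)) εdet≡1
                (∈p^ℤp-level (c g) c∈pᵏℤp (ℕ.m≤n+m k l)))
    where
    N = l ℕ.+ k
    to-class : (∃ λ γ → detℤ γ ≡ ε × pow p k ∣ c γ × InΓ-mod p l k (ε ·ᴹ adj γ *ᴹ approx N g)) →
               ∃ λ γ → detℤ γ ≡ ε × pow p k ∣ c γ × SameClass l k (ιM γ) g
    to-class (γ , det-γ≡ε , pᵏ∣cγ , H∈Γ) =
      γ , det-γ≡ε , pᵏ∣cγ , SameClass-from-level l k g γ ε g-unit ε²≡1 det-γ≡ε H∈Γ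

proposition4p4 : (p : ℕ) → Prime p → (l k : ℕ) →
    ((g : M2 (ℤp p)) → InG± l k g →
      ∃ λ γ → InΓ₀GL2ℤ p k γ × SameClass l k (ιM γ) g)
    × ((g : M2 (ℤp p)) → InG¹ l k g →
      ∃ λ γ → InΓ₀SL2ℤ p k γ × SameClass l k (ιM γ) g)
proposition4p4 p p-prime l k = lift± , lift¹
  where
  instance
    p-nonZero : ℕ.NonZero p
    p-nonZero = prime⇒nonZero p-prime

  one·det : ∀ (x : ℤp p) → InU l x → 1ℤ * seq x (l ℕ.+ k) ≡ 1ℤ mod pow p l
  one·det x x∈U =
    subst (_≡ 1ℤ mod pow p l) (sym (*-identityˡ _)) (InU-level x l x∈U (ℕ.m≤m+n l k))

  minus-one·det : ∀ (x : ℤp p) → InU l (⊝ x) → -1ℤ * seq x (l ℕ.+ k) ≡ 1ℤ mod pow p l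
  minus-one·det x -x∈U =
    subst (_≡ 1ℤ mod pow p l) (sym (-1*i≡-i _)) (InU-level (⊝ x) l -x∈U (ℕ.m≤m+n l k))

  lift± : (g : M2 (ℤp p)) → InG± l k g → ∃ λ γ → InΓ₀GL2ℤ p k γ × SameClass l k (ιM γ) g
  lift± g (g∈Γ₀ , inj₁ det∈U) =
    map₂ (λ (det≡1 , pᵏ∣c , class) → (inj₁ det≡1 , pᵏ∣c) , class)
      (Γ₀-representative p-prime l k g g∈Γ₀ 1ℤ refl (one·det (det g) det∈U))
  lift± g (g∈Γ₀ , inj₂ -det∈U) =
    map₂ (λ (det≡-1 , pᵏ∣c , class) → (inj₂ det≡-1 , pᵏ∣c) , class)
      (Γ₀-representative p-prime l k g g∈Γ₀ -1ℤ refl (minus-one·det (det g) -det∈U))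

  lift¹ : (g : M2 (ℤp p)) → InG¹ l k g → ∃ λ γ → InΓ₀SL2ℤ p k γ × SameClass l k (ιM γ) g
  lift¹ g (g∈Γ₀ , det∈U) =
    map₂ (λ (det≡1 , pᵏ∣c , class) → (det≡1 , pᵏ∣c) , class)
      (Γ₀-representative p-prime l k g g∈Γ₀ 1ℤ refl (one·det (det g) det∈U))
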